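{- Let $A, B, X$ be finite sets with contention and let $f : A \to \mathcal{P}_c X$ and $g : B \to \mathcal{P}_c X$ be morphisms of sets with contention. Then every $(f,g)$-synchronisation $(U,V)$ is the pointwise union of the minimal $(f,g)$-synchronisations it contains; that is, if $\{(U_i, V_i)\}_{i \in I}$ is the set of minimal synchronisations with $(U_i,V_i) \subseteq (U,V)$, then $U = \bigcup_i U_i$ and $V = \bigcup_i V_i$.
   Context: A set with contention ($c$-set) is a pair $(X, \frown_X)$ with $\frown_X \subseteq X \times X$ reflexive and symmetric. A morphism of $c$-sets $h : X \to Y$ is a function such that $h(x) \frown_Y h(x')$ implies $x \frown_X x'$. A subset $U \subseteq X$ is independent if $u \frown_X u'$ implies $u = u'$ for all $u,u' \in U$; $\mathcal{P}_c X$ is the set of independent subsets of $X$, a $c$-set with $U \frown V$ iff some $u \in U$, $v \in V$ satisfy $u \frown_X v$. For $h : X \to \mathcal{P}_c Y$ and $U \in \mathcal{P}_c X$, $h^\#(U) = \bigcup_{u \in U} h(u)$. An $(f,g)$-synchronisation is a pair $(U, V)$ with $U \in \mathcal{P}_c A$, $V \in \mathcal{P}_c B$ and $f^\#(U) = g^\#(V)$. Synchronisations are ordered pointwise: $(U,V) \subseteq (U',V')$ iff $U \subseteq U'$ and $V \subseteq V'$. The trivial synchronisation is $(\varnothing, \varnothing)$. A synchronisation $(U,V)$ is minimal if it is not trivial and every synchronisation $(U',V') \subseteq (U,V)$ is either trivial or equal to $(U,V)$. -}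

module Defs where

open import Data.Nat using (ℕ)
open import Data.Fin using (Fin)
open import Data.Fin.Subset using (Subset; _∈_; _⊆_; ⊥)
open import Data.Product using (Σ; ∃; _×_; _,_)
open import Data.Sum using (_⊎_)
open import Relation.Binary.PropositionalEquality using (_≡_)
open import Relation.Binary.Definitions using (Reflexive; Symmetric; Decidable)
open import Relation.Nullary using (¬_)

-- A finite set with contention: carrier Fin size, with a reflexive,
-- symmetric (and, being a relation on a finite set, decidable) relation.
record CSet : Set₁ where
  field
    size    : ℕ
    _⌢_     : Fin size → Fin size → Set
    ⌢-refl  : Reflexive _⌢_
    ⌢-sym   : Symmetric _⌢_
    ⌢-dec   : Decidable _⌢_
open CSet public

Carrier : CSet → Set
Carrier X = Fin (size X)

Sub : CSet → Set
Sub X = Subset (size X)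

Independent : (X : CSet) → Sub X → Set
Independent X U = ∀ u u' → u ∈ U → u' ∈ U → _⌢_ X u u' → u ≡ u'

PcCont : (X : CSet) → Sub X → Sub X → Set
PcCont X U V = ∃ λ u → ∃ λ v → u ∈ U × v ∈ V × _⌢_ X u v

record PcMor (A X : CSet) : Set where
  field
    fun   : Carrier A → Sub X
    indep : ∀ a → Independent X (fun a)
    mor   : ∀ a a' → PcCont X (fun a) (fun a') → _⌢_ A a a'
open PcMor public

_∈#[_]_ : {A X : CSet} → Carrier X → PcMor A X → Sub A → Set
x ∈#[ h ] U = ∃ λ u → u ∈ U × x ∈ fun h u

IsSync : {A B X : CSet} → PcMor A X → PcMor B X → Sub A → Sub B → Set
IsSync {A} {B} {X} f g U V =
  Independent A U × Independent B V ×
  (∀ (x : Carrier X) → (x ∈#[ f ] U → x ∈#[ g ] V) × (x ∈#[ g ] V → x ∈#[ f ] U))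

Trivial : {A B : CSet} → Sub A → Sub B → Set
Trivial U V = (U ≡ ⊥) × (V ≡ ⊥)

IsMinimalSync : {A B X : CSet} → PcMor A X → PcMor B X → Sub A → Sub B → Set
IsMinimalSync {A} {B} f g U V =
  IsSync f g U V × ¬ Trivial {A} {B} U V ×
  (∀ (U' : Sub A) (V' : Sub B) → IsSync f g U' V' → U' ⊆ U → V' ⊆ V →
     Trivial {A} {B} U' V' ⊎ ((U' ≡ U) × (V' ≡ V)))

module Submission where

-- The key observation is that synchronisations can be subtracted: if
-- (U',V') ⊆ (U,V) are synchronisations then so is (U ∖ U', V ∖ V').
-- This uses independence of U (and V): since f is a morphism into P_c X,
-- the images f(u) of distinct elements of an independent set are disjoint.
--
-- The theorem then follows by well-founded induction on |U| + |V|.  Given a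
-- point a ∈ U (or b ∈ V), either (U,V) is already minimal, or (all data
-- being finite, hence decidable) it has a proper nontrivial
-- sub-synchronisation (U',V').  Both (U',V') and (U ∖ U', V ∖ V') are then
-- strictly smaller synchronisations and one of them still contains the
-- point; the induction hypothesis applies to that one.  We prove this for
-- an arbitrary property P of synchronisations that excludes the trivial one
-- and is inherited by one of the two halves of every such split.

open import Defs
open import Data.Bool using (_≟_)
open import Data.Fin.Properties using (any?; all?) renaming (_≟_ to _≟ᶠ_)
open import Data.Fin.Subset
  using (Subset; _∈_; _∉_; _⊆_; _⊂_; _∩_; ∁; ∣_∣; ⊥; Nonempty)
open import Data.Fin.Subset.Properties
  using (_∈?_; _⊆?_; anySubset?; ⊆-antisym; ∉⊥; Empty-unique; x∈p∩q⁺; x∈p∩q⁻; p∩q⊆p;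
         x∈∁p⇒x∉p; x∉p⇒x∈∁p; p⊆q⇒∣p∣≤∣q∣; p⊂q⇒∣p∣<∣q∣)
open import Data.Nat using (_+_; _<_)
open import Data.Nat.Induction using (<-wellFounded)
open import Data.Nat.Properties using (+-mono-<-≤; +-mono-≤-<)
open import Data.Product using (∃; ∃₂; _×_; _,_; proj₁; proj₂)
open import Data.Sum using (_⊎_; inj₁; inj₂)
open import Data.Vec.Properties using (≡-dec)
open import Induction.WellFounded using (Acc; acc)
open import Relation.Binary.PropositionalEquality using (_≡_; _≢_; subst; sym)
open import Relation.Nullary using (¬_; Dec; yes; no; contradiction)
open import Relation.Nullary.Decidable using (_×-dec_; _→-dec_; ¬?)

_≟ˢ_ : ∀ {n} (p q : Subset n) → Dec (p ≡ q)
_≟ˢ_ = ≡-dec _≟_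

⊆-≢⇒⊂ : ∀ {n} {p q : Subset n} → p ⊆ q → p ≢ q → p ⊂ q
⊆-≢⇒⊂ {p = p} {q} p⊆q p≢q with any? (λ x → (x ∈? q) ×-dec ¬? (x ∈? p))
... | yes (x , x∈q , x∉p) = p⊆q , x , x∈q , x∉p
... | no noWitness = contradiction (⊆-antisym p⊆q q⊆p) p≢q
  where
  q⊆p : q ⊆ p
  q⊆p {x} x∈q with x ∈? p
  ... | yes x∈p = x∈p
  ... | no x∉p = contradiction (x , x∈q , x∉p) noWitness

pair-shrinks : ∀ {m n} {U U' : Subset m} {V V' : Subset n} → U' ⊆ U → V' ⊆ V →
  ¬ (U' ≡ U × V' ≡ V) → ∣ U' ∣ + ∣ V' ∣ < ∣ U ∣ + ∣ V ∣
pair-shrinks {U = U} {U'} U'⊆U V'⊆V notBoth with U' ≟ˢ U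
... | yes U'≡U = +-mono-≤-< (p⊆q⇒∣p∣≤∣q∣ U'⊆U)
                            (p⊂q⇒∣p∣<∣q∣ (⊆-≢⇒⊂ V'⊆V λ V'≡V → notBoth (U'≡U , V'≡V)))
... | no U'≢U = +-mono-<-≤ (p⊂q⇒∣p∣<∣q∣ (⊆-≢⇒⊂ U'⊆U U'≢U)) (p⊆q⇒∣p∣≤∣q∣ V'⊆V)

_∖_ : ∀ {n} → Subset n → Subset n → Subset n
U ∖ U' = U ∩ ∁ U'

∖-⊆ : ∀ {n} (U U' : Subset n) → U ∖ U' ⊆ U
∖-⊆ U U' = p∩q⊆p U (∁ U')

∈∖⁺ : ∀ {n} {U U' : Subset n} {x} → x ∈ U → x ∉ U' → x ∈ U ∖ U'
∈∖⁺ x∈U x∉U' = x∈p∩q⁺ (x∈U , x∉p⇒x∈∁p x∉U')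

∈∖⁻ : ∀ {n} (U U' : Subset n) {x} → x ∈ U ∖ U' → x ∈ U × x ∉ U'
∈∖⁻ U U' x∈U∖U' with x∈p∩q⁻ U (∁ U') x∈U∖U'
... | x∈U , x∈∁U' = x∈U , x∈∁p⇒x∉p x∈∁U'

∖-unchanged⇒empty : ∀ {n} {U U' : Subset n} → U' ⊆ U → U ∖ U' ≡ U → U' ≡ ⊥
∖-unchanged⇒empty {U = U} {U'} U'⊆U U∖U'≡U = Empty-unique empty
  where
  empty : ¬ Nonempty U'
  empty (x , x∈U') =
    proj₂ (∈∖⁻ U U' (subst (x ∈_) (sym U∖U'≡U) (U'⊆U x∈U'))) x∈U'

independent? : (Y : CSet) (W : Sub Y) → Dec (Independent Y W)
independent? Y W = all? λ u → all? λ u' →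
  (u ∈? W) →-dec ((u' ∈? W) →-dec (⌢-dec Y u u' →-dec (u ≟ᶠ u')))

independent-⊆ : (Y : CSet) {U W : Sub Y} → Independent Y U → W ⊆ U → Independent Y W
independent-⊆ Y indU W⊆U u u' u∈W u'∈W = indU u u' (W⊆U u∈W) (W⊆U u'∈W)

module _ {X : CSet} where

  _∈#[_]?_ : {Y : CSet} (x : Carrier X) (h : PcMor Y X) (W : Sub Y) → Dec (x ∈#[ h ] W)
  x ∈#[ h ]? W = any? λ u → (u ∈? W) ×-dec (x ∈? fun h u)

  -- A morphism maps distinct elements of an independent set to disjoint
  -- subsets: a common point x would make h(u) and h(u') contend.
  images-disjoint : {Y : CSet} (h : PcMor Y X) {W : Sub Y} → Independent Y W →
    ∀ {u u' x} → u ∈ W → u' ∈ W → x ∈ fun h u → x ∈ fun h u' → u ≡ u'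
  images-disjoint h indW {u} {u'} {x} u∈W u'∈W x∈hu x∈hu' =
    indW u u' u∈W u'∈W (mor h u u' (x , x , x∈hu , x∈hu' , ⌢-refl X))

  -- One half of  h#(U ∖ U') = k#(V ∖ V')  for nested synchronisations:
  -- a point of h(u), u ∈ U ∖ U', lies in some k(v) with v ∈ V; were v ∈ V',
  -- the point would also lie in h(u') for some u' ∈ U', forcing u = u' ∈ U'.
  image-∖-⊆ : {Y Z : CSet} (h : PcMor Y X) (k : PcMor Z X)
    {U U' : Sub Y} {V V' : Sub Z} → Independent Y U → U' ⊆ U →
    (∀ x → x ∈#[ h ] U → x ∈#[ k ] V) → (∀ x → x ∈#[ k ] V' → x ∈#[ h ] U') →
    ∀ x → x ∈#[ h ] (U ∖ U') → x ∈#[ k ] (V ∖ V')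
  image-∖-⊆ h k {U} {U'} {V} {V'} indU U'⊆U hU⊆kV kV'⊆hU' x (u , u∈U∖U' , x∈hu)
    with ∈∖⁻ U U' u∈U∖U'
  ... | u∈U , u∉U' with hU⊆kV x (u , u∈U , x∈hu)
  ... | v , v∈V , x∈kv with v ∈? V'
  ... | no v∉V' = v , ∈∖⁺ v∈V v∉V' , x∈kv
  ... | yes v∈V' with kV'⊆hU' x (v , v∈V' , x∈kv)
  ... | u' , u'∈U' , x∈hu' =
    contradiction (subst (_∈ U') (sym (images-disjoint h indU u∈U (U'⊆U u'∈U') x∈hu x∈hu')) u'∈U')
                  u∉U'

module _ {A B X : CSet} (f : PcMor A X) (g : PcMor B X) where

  sync? : ∀ U V → Dec (IsSync f g U V)
  sync? U V = independent? A U ×-dec (independent? B V ×-dec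
    all? λ x → ((x ∈#[ f ]? U) →-dec (x ∈#[ g ]? V)) ×-dec ((x ∈#[ g ]? V) →-dec (x ∈#[ f ]? U)))

  sync-∖ : ∀ {U V U' V'} → IsSync f g U V → IsSync f g U' V' → U' ⊆ U → V' ⊆ V →
    IsSync f g (U ∖ U') (V ∖ V')
  sync-∖ {U} {V} {U'} {V'} (indU , indV , fU=gV) (_ , _ , fU'=gV') U'⊆U V'⊆V =
    independent-⊆ A indU (∖-⊆ U U') , independent-⊆ B indV (∖-⊆ V V') ,
    λ x → image-∖-⊆ f g indU U'⊆U (λ y → proj₁ (fU=gV y)) (λ y → proj₂ (fU'=gV' y)) x
        , image-∖-⊆ g f indV V'⊆V (λ y → proj₂ (fU=gV y)) (λ y → proj₁ (fU'=gV' y)) x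

  trivial? : ∀ U V → Dec (Trivial {A} {B} U V)
  trivial? U V = (U ≟ˢ ⊥) ×-dec (V ≟ˢ ⊥)

  ProperSubSync : Sub A → Sub B → Sub A → Sub B → Set
  ProperSubSync U V U' V' = IsSync f g U' V' × U' ⊆ U × V' ⊆ V ×
    ¬ Trivial {A} {B} U' V' × ¬ (U' ≡ U × V' ≡ V)

  minimal-or-split : ∀ {U V} → IsSync f g U V → ¬ Trivial {A} {B} U V →
    IsMinimalSync f g U V ⊎ ∃₂ (ProperSubSync U V)
  minimal-or-split {U} {V} syncUV nontrivial
    with anySubset? (λ U' → anySubset? λ V' →
           sync? U' V' ×-dec ((U' ⊆? U) ×-dec ((V' ⊆? V) ×-dec
             (¬? (trivial? U' V') ×-dec ¬? ((U' ≟ˢ U) ×-dec (V' ≟ˢ V))))))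
  ... | yes (U' , V' , U'⊆U , V'⊆V , rest) = inj₂ (U' , V' , U'⊆U , V'⊆V , rest)
  ... | no noSplit = inj₁ (syncUV , nontrivial , trivial-or-equal)
    where
    trivial-or-equal : ∀ U' V' → IsSync f g U' V' → U' ⊆ U → V' ⊆ V →
      Trivial {A} {B} U' V' ⊎ ((U' ≡ U) × (V' ≡ V))
    trivial-or-equal U' V' syncU'V' U'⊆U V'⊆V with trivial? U' V' | (U' ≟ˢ U) ×-dec (V' ≟ˢ V)
    ... | yes trivial | _ = inj₁ trivial
    ... | no _ | yes equal = inj₂ equal
    ... | no nontrivial' | no unequal =
      contradiction (U' , V' , syncU'V' , (λ {x} → U'⊆U {x}) , (λ {x} → V'⊆V {x}) ,
                     nontrivial' , unequal) noSplit

  MinimalBelow : (Sub A → Sub B → Set) → Sub A → Sub B → Set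
  MinimalBelow P U V = ∃ λ (Ui : Sub A) → ∃ λ (Vi : Sub B) →
    IsMinimalSync f g Ui Vi × Ui ⊆ U × Vi ⊆ V × P Ui Vi

  MinimalBelow-⊆ : ∀ {P U V U' V'} → U' ⊆ U → V' ⊆ V →
    MinimalBelow P U' V' → MinimalBelow P U V
  MinimalBelow-⊆ U'⊆U V'⊆V (Ui , Vi , minimal , Ui⊆U' , Vi⊆V' , p) =
    Ui , Vi , minimal , (λ x∈Ui → U'⊆U (Ui⊆U' x∈Ui)) , (λ x∈Vi → V'⊆V (Vi⊆V' x∈Vi)) , p

  minimal-witness : (P : Sub A → Sub B → Set) →
    (∀ {U V} → P U V → ¬ Trivial {A} {B} U V) →
    (∀ {U V U' V'} → P U V → P U' V' ⊎ P (U ∖ U') (V ∖ V')) →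
    ∀ U V → IsSync f g U V → P U V → MinimalBelow P U V
  minimal-witness P P-nontrivial P-split U V = go U V (<-wellFounded (∣ U ∣ + ∣ V ∣))
    where
    go : ∀ U V → Acc _<_ (∣ U ∣ + ∣ V ∣) → IsSync f g U V → P U V → MinimalBelow P U V
    go U V (acc smaller) syncUV pUV with minimal-or-split syncUV (P-nontrivial pUV)
    ... | inj₁ minimal = U , V , minimal , (λ x∈U → x∈U) , (λ x∈V → x∈V) , pUV
    ... | inj₂ (U' , V' , syncU'V' , U'⊆U , V'⊆V , nontrivial' , unequal) with P-split pUV
    ...   | inj₁ pU'V' =
      MinimalBelow-⊆ U'⊆U V'⊆V
        (go U' V' (smaller (pair-shrinks U'⊆U V'⊆V unequal)) syncU'V' pU'V')
    ...   | inj₂ pRest =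
      MinimalBelow-⊆ (∖-⊆ U U') (∖-⊆ V V')
        (go (U ∖ U') (V ∖ V') (smaller (pair-shrinks (∖-⊆ U U') (∖-⊆ V V') restShrinks))
            (sync-∖ syncUV syncU'V' U'⊆U V'⊆V) pRest)
      where
      restShrinks : ¬ (U ∖ U' ≡ U × V ∖ V' ≡ V)
      restShrinks (U-unchanged , V-unchanged) =
        nontrivial' (∖-unchanged⇒empty U'⊆U U-unchanged , ∖-unchanged⇒empty V'⊆V V-unchanged)

lemma3 : {A B X : CSet} (f : PcMor A X) (g : PcMor B X) (U : Sub A) (V : Sub B) →
    IsSync f g U V →
    (∀ a → (a ∈ U → ∃ λ (Ui : Sub A) → ∃ λ (Vi : Sub B) →
               IsMinimalSync f g Ui Vi × Ui ⊆ U × Vi ⊆ V × a ∈ Ui)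
         × ((∃ λ (Ui : Sub A) → ∃ λ (Vi : Sub B) →
               IsMinimalSync f g Ui Vi × Ui ⊆ U × Vi ⊆ V × a ∈ Ui) → a ∈ U))
    ×
    (∀ b → (b ∈ V → ∃ λ (Ui : Sub A) → ∃ λ (Vi : Sub B) →
               IsMinimalSync f g Ui Vi × Ui ⊆ U × Vi ⊆ V × b ∈ Vi)
         × ((∃ λ (Ui : Sub A) → ∃ λ (Vi : Sub B) →
               IsMinimalSync f g Ui Vi × Ui ⊆ U × Vi ⊆ V × b ∈ Vi) → b ∈ V))
lemma3 f g U V syncUV =
  (λ a → minimal-witness f g (λ U' _ → a ∈ U')
           (λ a∈U' (U'≡⊥ , _) → ∉⊥ (subst (a ∈_) U'≡⊥ a∈U'))
           (λ {_} {_} {U'} a∈U → split a∈U (a ∈? U'))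
           U V syncUV
       , λ (_ , _ , _ , Ui⊆U , _ , a∈Ui) → Ui⊆U a∈Ui)
  ,
  (λ b → minimal-witness f g (λ _ V' → b ∈ V')
           (λ b∈V' (_ , V'≡⊥) → ∉⊥ (subst (b ∈_) V'≡⊥ b∈V'))
           (λ {_} {_} {_} {V'} b∈V → split b∈V (b ∈? V'))
           U V syncUV
       , λ (_ , _ , _ , _ , Vi⊆V , b∈Vi) → Vi⊆V b∈Vi)
  where
  split : ∀ {n} {U U' : Subset n} {x} → x ∈ U → Dec (x ∈ U') → x ∈ U' ⊎ x ∈ U ∖ U'
  split x∈U (yes x∈U') = inj₁ x∈U'
  split x∈U (no x∉U') = inj₂ (∈∖⁺ x∈U x∉U')
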